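{- Let $X=\{x_1,\ldots,x_n\}$ and let $I\subset\mathbb{Z}[X]$ be a monomial ideal containing $x_1^2,\ldots,x_n^2$ which is spherical. Then all resolutions of $I$ are spherical, all maximal resolutions of $I$ have the same depth, and $I$ has a unique core up to permutation of the variables (i.e. for any two maximal resolutions $A,A'$ there is a permutation $\sigma$ of the variables with $c(A)=\sigma(c(A'))$).
   Context: $R(I)$ denotes the simplicial complex of monomials not in $I$. $(I:x)=\{m:xm\in I\}$. $R(I)$ is a cone with apex $a\in X$ if $(I:a)=(I,a)$, i.e. $a$ divides no minimal monomial generator of $I$ other than the $x_i^2$. For $a,b\in X$, $a$ dominates $b$ in $I$ if $R(I)$ is not a cone with apex $b$ but $R((I,a))$ is a cone with apex $b$. For a sequence $A=(a_1,\ldots,a_r)$ of variables let $I_i=(I:a_1\cdots a_{i-1})$, $i\in[r+1]$. $A$ is a resolution of $I$ if for every $i\in[r]$, $a_i\notin I_i$ and either $R(I_i)$ is a cone with apex $a_i$ or there is $b_i\in X$ such that $a_i$ dominates $b_i$ in $I_i$. A resolution is maximal if it cannot be extended by appending a further variable to a resolution. The core of $A$ is $c(A)=I_{r+1}$, the depth is $d(A)=r$. $A$ is spherical if $R(I_i)$ is not a cone with apex $a_i$ for every $i\in[r]$. The ideal $I$ is spherical if it admits a maximal resolution which is spherical. -}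

module Defs where

open import Data.Nat using (ℕ; zero; suc; _+_; _≤_)
open import Data.Nat.Properties using ()
open import Data.Fin using (Fin; toℕ)
open import Data.Fin.Properties using () renaming (_≟_ to _≟ᶠ_)
open import Data.Fin.Permutation using (Permutation′; _⟨$⟩ʳ_)
open import Data.Bool using (Bool; true; false; if_then_else_; _∨_)
open import Data.List using (List; []; _∷_; length; take; lookup; _++_; [_])
open import Data.Product using (Σ; _×_; _,_)
open import Data.Sum using (_⊎_)
open import Relation.Nullary using (¬_)
open import Relation.Nullary.Decidable using (⌊_⌋)
open import Relation.Binary.PropositionalEquality using (_≡_)

Mon : ℕ → Set
Mon n = Fin n → ℕ

var : ∀ {n} → Fin n → Mon n
var i j = if ⌊ i ≟ᶠ j ⌋ then 1 else 0

one : ∀ {n} → Mon n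
one _ = 0

_·_ : ∀ {n} → Mon n → Mon n → Mon n
(u · v) i = u i + v i

_∣ᵐ_ : ∀ {n} → Mon n → Mon n → Set
u ∣ᵐ v = ∀ i → u i ≤ v i

prodVars : ∀ {n} → List (Fin n) → Mon n
prodVars [] = one
prodVars (a ∷ as) = var a · prodVars as

-- A monomial ideal of ℤ[X] is determined by the set of monomials it contains;
-- we represent it by the characteristic function of that set.
Ideal : ℕ → Set
Ideal n = Mon n → Bool

_∈ᴵ_ : ∀ {n} → Mon n → Ideal n → Set
m ∈ᴵ I = I m ≡ true

IsMonomialIdeal : ∀ {n} → Ideal n → Set
IsMonomialIdeal {n} I = ∀ (u v : Mon n) → u ∣ᵐ v → u ∈ᴵ I → v ∈ᴵ I

ContainsSquares : ∀ {n} → Ideal n → Set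
ContainsSquares {n} I = ∀ (i : Fin n) → (var i · var i) ∈ᴵ I

_≐_ : ∀ {n} → Ideal n → Ideal n → Set
I ≐ J = ∀ m → I m ≡ J m

colon : ∀ {n} → Ideal n → Mon n → Ideal n
colon I u m = I (u · m)

addVar : ∀ {n} → Ideal n → Fin n → Ideal n
addVar I a m = I m ∨ (if ⌊ m a Data.Nat.≟ 0 ⌋ then false else true)

-- R(I) is a cone with apex a  iff  (I : a) = (I, a)
IsCone : ∀ {n} → Ideal n → Fin n → Set
IsCone I a = colon I (var a) ≐ addVar I a

Dominates : ∀ {n} → Ideal n → Fin n → Fin n → Set
Dominates I a b = ¬ IsCone I b × IsCone (addVar I a) b

-- I_i = (I : a_1 ⋯ a_{i-1}); here indexed from 0: stage k uses the first k entries
stage : ∀ {n} → Ideal n → List (Fin n) → ℕ → Ideal n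
stage I A k = colon I (prodVars (take k A))

Resolution : ∀ {n} → Ideal n → List (Fin n) → Set
Resolution {n} I A = ∀ (i : Fin (length A)) →
  let J = stage I A (toℕ i) ; a = lookup A i in
  ¬ (var a ∈ᴵ J) × (IsCone J a ⊎ Σ (Fin n) (λ b → Dominates J a b))

MaximalResolution : ∀ {n} → Ideal n → List (Fin n) → Set
MaximalResolution {n} I A = Resolution I A × (∀ (a : Fin n) → ¬ Resolution I (A ++ [ a ]))

core : ∀ {n} → Ideal n → List (Fin n) → Ideal n
core I A = colon I (prodVars A)

depth : ∀ {n} → List (Fin n) → ℕ
depth A = length A

SphericalRes : ∀ {n} → Ideal n → List (Fin n) → Set
SphericalRes I A = ∀ (i : Fin (length A)) → ¬ IsCone (stage I A (toℕ i)) (lookup A i)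

SphericalIdeal : ∀ {n} → Ideal n → Set
SphericalIdeal {n} I = Σ (List (Fin n)) (λ A → MaximalResolution I A × SphericalRes I A)

-- σ(J): image of J under the variable renaming x_i ↦ x_{σ i};
-- m ∈ σ(J) iff m ∘ σ ∈ J
permIdeal : ∀ {n} → Permutation′ n → Ideal n → Ideal n
permIdeal σ J m = J (λ i → m (σ ⟨$⟩ʳ i))

-- Induction on the depth d of a maximal spherical resolution of I with core C: for every first step a of a
-- resolution of I, R(I) is not a cone with apex a, and (I : a) has a maximal spherical resolution of depth
-- d - 1 whose core is C up to renaming the variables.
-- Let a₀ start the given resolution. By induction R(I : a₀) is no cone at all (an apex c with x_c ∉ (I : a₀)
-- would be a non-spherical first step), so R(I) is no cone with apex a ≠ a₀ either, a dominates some b and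
-- a₀ dominates some b₀. If a and a₀ dominate each other, transposing x_a and x_a₀ maps (I : a₀) onto (I : a).
-- Otherwise, composing dominations, b may be taken outside {a, a₀}. Then x_a x_a₀ ∉ I (else R(I : a₀) would be
-- a cone with apex b), a is a first step of (I : a₀), and a₀ is a spherical first step of (I : a); as
-- (I : a₀ a) = (I : a a₀), the induction hypothesis for (I : a₀) gives a resolution of (I : a) starting with a₀.

module Submission where

open import Defs
open import Algebra.Properties.CommutativeSemigroup using (x∙yz≈y∙xz)
open import Data.Bool using (true; _∨_)
open import Data.Bool.Properties using (⇔→≡; ∨-identityʳ; ∨-zeroʳ) renaming (_≟_ to _≟ᵇ_)
open import Data.Empty using (⊥-elim)
open import Data.Fin using (Fin; toℕ) renaming (zero to fzero; suc to fsuc)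
open import Data.Fin.Permutation
  using (Permutation′; _⟨$⟩ʳ_; _⟨$⟩ˡ_; inverseˡ; flip; _∘ₚ_; transpose) renaming (id to idₚ)
open import Data.Fin.Properties using () renaming (_≟_ to _≟ᶠ_)
open import Data.List using (List; []; _∷_; length; take; _++_; [_]; map)
open import Data.List.Properties using (map-++; map-∘; map-cong; map-id; length-map)
open import Data.Nat using (ℕ; zero; suc; pred; _+_; _≤_; z≤n; s≤s)
open import Data.Nat.Properties
  using ( _≟_; +-assoc; +-comm; +-identityʳ; +-commutativeSemigroup; ≤-reflexive; m≤n+m; +-monoʳ-≤
        ; n≢0⇒n>0; n≤0⇒n≡0; suc-injective)
open import Data.Product using (Σ; _×_; _,_; proj₁; proj₂; map₂) renaming (map to map×)
open import Data.Sum using (_⊎_; inj₁; inj₂; [_,_]′) renaming (map to map⊎)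
open import Data.Unit using (⊤; tt)
open import Function using (_∘_; mk⇔)
open import Relation.Nullary using (¬_; Dec; yes; no)
open import Relation.Binary.PropositionalEquality
  using (_≡_; _≢_; _≗_; refl; sym; trans; cong; cong₂; subst; ≢-sym)

private variable
  n d : ℕ
  I J X Y Z C : Ideal n
  σ : Permutation′ n
  a b c x y a₀ b₀ : Fin n
  m : Mon n

-- Monomials

·-identityʳ : (u : Mon n) → u · one ≗ u
·-identityʳ u i = +-identityʳ (u i)

·-assoc : (u v w : Mon n) → (u · v) · w ≗ u · (v · w)
·-assoc u v w i = +-assoc (u i) (v i) (w i)

·-comm : (u v : Mon n) → u · v ≗ v · u
·-comm u v i = +-comm (u i) (v i)

·-left-comm : (u v w : Mon n) → u · (v · w) ≗ v · (u · w)
·-left-comm u v w i = x∙yz≈y∙xz +-commutativeSemigroup (u i) (v i) (w i)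

·-congˡ : (w : Mon n) {u v : Mon n} → u ≗ v → w · u ≗ w · v
·-congˡ w u≗v i = cong (w i +_) (u≗v i)

var-self : (a : Fin n) → var a a ≡ 1
var-self a with a ≟ᶠ a
... | yes _   = refl
... | no a≢a = ⊥-elim (a≢a refl)

var-other : a ≢ b → var a b ≡ 0
var-other {a = a} {b} a≢b with a ≟ᶠ b
... | yes a≡b = ⊥-elim (a≢b a≡b)
... | no _    = refl

·-var-other : (m : Mon n) → x ≢ c → (var x · m) c ≡ m c
·-var-other m x≢c = cong (_+ m _) (var-other x≢c)

var-·-present : (m : Mon n) (a : Fin n) → (var a · m) a ≢ 0
var-·-present m a rewrite var-self a = λ ()

var-∣ : m a ≢ 0 → var a ∣ᵐ m
var-∣ {a = a} ma≢0 i with a ≟ᶠ i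
... | yes refl = n≢0⇒n>0 ma≢0
... | no _     = z≤n

erase : Fin n → Mon n → Mon n
erase c m i with c ≟ᶠ i
... | yes _ = 0
... | no _  = m i

erase-self : (c : Fin n) (m : Mon n) → erase c m c ≡ 0
erase-self c m with c ≟ᶠ c
... | yes _   = refl
... | no c≢c = ⊥-elim (c≢c refl)

erase-other : (m : Mon n) → c ≢ x → erase c m x ≡ m x
erase-other {c = c} {x} m c≢x with c ≟ᶠ x
... | yes c≡x = ⊥-elim (c≢x c≡x)
... | no _    = refl

erase-simple : (c : Fin n) → m c ≡ 1 → m ≗ var c · erase c m
erase-simple c mc≡1 i with c ≟ᶠ i
... | yes refl = mc≡1
... | no _     = refl

data Multiplicity (k : ℕ) : Set where
  absent   : k ≡ 0 → Multiplicity k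
  simple   : k ≡ 1 → Multiplicity k
  repeated : 2 ≤ k → Multiplicity k

multiplicity : (k : ℕ) → Multiplicity k
multiplicity 0             = absent refl
multiplicity 1             = simple refl
multiplicity (suc (suc k)) = repeated (s≤s (s≤s z≤n))

-- Monomial ideals containing the squares

record Admissible (I : Ideal n) : Set where
  field
    closed  : IsMonomialIdeal I
    squares : ContainsSquares I

open Admissible

_∈ᴵ?_ : (m : Mon n) (I : Ideal n) → Dec (m ∈ᴵ I)
m ∈ᴵ? I = I m ≟ᵇ true

∈-resp-≗ : Admissible I → {u v : Mon n} → u ≗ v → u ∈ᴵ I → v ∈ᴵ I
∈-resp-≗ adm u≗v = closed adm _ _ (λ i → ≤-reflexive (u≗v i))

member-resp-≗ : Admissible I → {u v : Mon n} → u ≗ v → I u ≡ I v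
member-resp-≗ adm u≗v = ⇔→≡ (mk⇔ (∈-resp-≗ adm u≗v) (∈-resp-≗ adm (sym ∘ u≗v)))

∈-·ˡ : Admissible I → (u : Mon n) → m ∈ᴵ I → (u · m) ∈ᴵ I
∈-·ˡ adm u = closed adm _ _ (λ i → m≤n+m _ (u i))

square-∈ : Admissible I → (c : Fin n) → 2 ≤ m c → m ∈ᴵ I
square-∈ {m = m} adm c 2≤mc = closed adm _ _ divides (squares adm c)
  where
  divides : (var c · var c) ∣ᵐ m
  divides i with c ≟ᶠ i
  ... | yes refl = 2≤mc
  ... | no _     = z≤n

var-·-∈ : Admissible I → (c : Fin n) → m c ≢ 0 → (var c · m) ∈ᴵ I
var-·-∈ {m = m} adm c mc≢0 =
  square-∈ adm c (subst (λ k → 2 ≤ k + m c) (sym (var-self c)) (s≤s (n≢0⇒n>0 mc≢0)))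

∈-by-multiplicity : Admissible I → (x : Fin n) →
                    (m x ≡ 0 → m ∈ᴵ I) → (m x ≡ 1 → erase x m ∈ᴵ I) → m ∈ᴵ I
∈-by-multiplicity {m = m} adm x absent-case simple-case with multiplicity (m x)
... | absent mx≡0    = absent-case mx≡0
... | simple mx≡1    = ∈-resp-≗ adm (sym ∘ erase-simple x mx≡1) (∈-·ˡ adm (var x) (simple-case mx≡1))
... | repeated 2≤mx = square-∈ adm x 2≤mx

lk : Fin n → Ideal n → Ideal n
lk a I = colon I (var a)

admissible-colon : Admissible I → (u : Mon n) → Admissible (colon I u)
admissible-colon adm u = record
  { closed  = λ v w v∣w → closed adm _ _ (λ i → +-monoʳ-≤ (u i) (v∣w i))
  ; squares = λ i → ∈-·ˡ adm u (squares adm i)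
  }

admissible-lk : Admissible I → (a : Fin n) → Admissible (lk a I)
admissible-lk adm a = admissible-colon adm (var a)

∈-addVar⁺ˡ : (I : Ideal n) (a : Fin n) → m ∈ᴵ I → m ∈ᴵ addVar I a
∈-addVar⁺ˡ I a m∈I rewrite m∈I = refl

∈-addVar⁺ʳ : (I : Ideal n) (a : Fin n) → m a ≢ 0 → m ∈ᴵ addVar I a
∈-addVar⁺ʳ {m = m} I a ma≢0 with m a ≟ 0
... | yes ma≡0 = ⊥-elim (ma≢0 ma≡0)
... | no _     = ∨-zeroʳ (I m)

∈-addVar⁻ : (I : Ideal n) (a : Fin n) → m ∈ᴵ addVar I a → m ∈ᴵ I ⊎ m a ≢ 0
∈-addVar⁻ {m = m} I a m∈ with m a ≟ 0
... | yes _    = inj₁ (trans (sym (∨-identityʳ (I m))) m∈)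
... | no ma≢0 = inj₂ ma≢0

addVar-absent : (I : Ideal n) (a : Fin n) → m a ≡ 0 → addVar I a m ≡ I m
addVar-absent {m = m} I a ma≡0 with m a ≟ 0
... | yes _    = ∨-identityʳ (I m)
... | no ma≢0 = ⊥-elim (ma≢0 ma≡0)

admissible-addVar : Admissible I → (a : Fin n) → Admissible (addVar I a)
admissible-addVar {I = I} adm a = record { closed = closed′ ; squares = ∈-addVar⁺ˡ I a ∘ squares adm }
  where
  closed′ : IsMonomialIdeal (addVar I a)
  closed′ v w v∣w v∈ with ∈-addVar⁻ I a v∈
  ... | inj₁ v∈I  = ∈-addVar⁺ˡ I a (closed adm v w v∣w v∈I)
  ... | inj₂ va≢0 = ∈-addVar⁺ʳ I a λ wa≡0 → va≢0 (n≤0⇒n≡0 (subst (v a ≤_) wa≡0 (v∣w a)))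

-- Cones and domination

ConeAt : Ideal n → Fin n → Set
ConeAt {n} I c = ∀ (m : Mon n) → m c ≡ 0 → (var c · m) ∈ᴵ I → m ∈ᴵ I

-- R((I, a)) is a cone with apex b.
ConeModulo : Ideal n → Fin n → Fin n → Set
ConeModulo {n} I a b = ∀ (m : Mon n) → m a ≡ 0 → m b ≡ 0 → (var b · m) ∈ᴵ I → m ∈ᴵ I

record Dominance (I : Ideal n) (a b : Fin n) : Set where
  constructor dominance
  field
    distinct   : a ≢ b
    notCone    : ¬ ConeAt I b
    coneModulo : ConeModulo I a b

Step : Ideal n → Fin n → Set
Step {n} I a = ¬ (var a ∈ᴵ I) × (ConeAt I a ⊎ Σ (Fin n) (Dominance I a))

step⇒dominance : Step I a → ¬ ConeAt I a → Σ (Fin n) (Dominance I a)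
step⇒dominance (_ , inj₁ cone) ¬cone = ⊥-elim (¬cone cone)
step⇒dominance (_ , inj₂ dom)  _     = dom

isCone⇒coneAt : IsCone I c → ConeAt I c
isCone⇒coneAt {I = I} {c = c} cone m mc≡0 = trans (sym (trans (cone m) (addVar-absent I c mc≡0)))

coneAt⇒isCone : Admissible I → ConeAt I c → IsCone I c
coneAt⇒isCone {I = I} {c = c} adm cone m with m c ≟ 0
... | yes mc≡0 = trans (⇔→≡ (mk⇔ (cone m mc≡0) (∈-·ˡ adm (var c)))) (sym (∨-identityʳ (I m)))
... | no mc≢0  = trans (var-·-∈ adm c mc≢0) (sym (∨-zeroʳ (I m)))

one-∈⇒coneAt : Admissible I → one ∈ᴵ I → ConeAt I c
one-∈⇒coneAt adm one∈I m _ _ = closed adm one m (λ _ → z≤n) one∈I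

dominates⇒dominance : Admissible I → Dominates I a b → Dominance I a b
dominates⇒dominance {I = I} {a = a} {b = b} adm (¬cone , deletionCone) =
  dominance a≢b (¬cone ∘ coneAt⇒isCone adm) coneModulo′
  where
  deletion-coneAt : ConeAt (addVar I a) b
  deletion-coneAt = isCone⇒coneAt deletionCone

  a≢b : a ≢ b
  a≢b refl with ∈-addVar⁻ I a (deletion-coneAt one refl (∈-addVar⁺ʳ I a (var-·-present one a)))
  ... | inj₁ one∈I = ¬cone (coneAt⇒isCone adm (one-∈⇒coneAt adm one∈I))
  ... | inj₂ 1a≢0  = 1a≢0 refl

  coneModulo′ : ConeModulo I a b
  coneModulo′ m ma≡0 mb≡0 bm∈I with ∈-addVar⁻ I a (deletion-coneAt m mb≡0 (∈-addVar⁺ˡ I a bm∈I))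
  ... | inj₁ m∈I  = m∈I
  ... | inj₂ ma≢0 = ⊥-elim (ma≢0 ma≡0)

dominance⇒dominates : Admissible I → Dominance I a b → Dominates I a b
dominance⇒dominates {I = I} {a = a} {b = b} adm (dominance a≢b ¬cone cm) =
  ¬cone ∘ isCone⇒coneAt , coneAt⇒isCone (admissible-addVar adm a) deletion-coneAt
  where
  deletion-coneAt : ConeAt (addVar I a) b
  deletion-coneAt m mb≡0 bm∈ =
    [ ∈-addVar⁺ˡ I a , ∈-addVar⁺ʳ I a ]′ (member-or-present (∈-addVar⁻ I a bm∈))
    where
    member-or-present : (var b · m) ∈ᴵ I ⊎ (var b · m) a ≢ 0 → m ∈ᴵ I ⊎ m a ≢ 0
    member-or-present (inj₂ bma≢0) = inj₂ (bma≢0 ∘ trans (·-var-other m (≢-sym a≢b)))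
    member-or-present (inj₁ bm∈I) with m a ≟ 0
    ... | yes ma≡0 = inj₁ (cm m ma≡0 mb≡0 bm∈I)
    ... | no ma≢0  = inj₂ ma≢0

coneAt-lk : Admissible I → ConeAt I c → c ≢ x → ConeAt (lk x I) c
coneAt-lk {c = c} {x = x} adm cone c≢x m mc≡0 cm∈ =
  cone (var x · m) (trans (·-var-other m (≢-sym c≢x)) mc≡0) (∈-resp-≗ adm (·-left-comm (var x) (var c) m) cm∈)

coneModulo-lk : Admissible I → ConeModulo I a b → b ≢ x → a ≢ x → ConeModulo (lk x I) a b
coneModulo-lk {b = b} {x = x} adm cm b≢x a≢x m ma≡0 mb≡0 bm∈ =
  cm (var x · m) (trans (·-var-other m (≢-sym a≢x)) ma≡0) (trans (·-var-other m (≢-sym b≢x)) mb≡0)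
     (∈-resp-≗ adm (·-left-comm (var x) (var b) m) bm∈)

coneModulo-trans : Admissible I → ConeModulo I a x → ConeModulo I x y →
                   y ≢ a → y ≢ x → a ≢ x → ConeModulo I a y
coneModulo-trans {I = I} {x = x} {y = y} adm cmᵃˣ cmˣʸ y≢a y≢x a≢x m ma≡0 my≡0 ym∈ =
  ∈-by-multiplicity adm x (λ mx≡0 → cmˣʸ m mx≡0 my≡0 ym∈) g∈I
  where
  g = erase x m
  g∈I : m x ≡ 1 → g ∈ᴵ I
  g∈I mx≡1 = cmˣʸ g (erase-self x m) (trans (erase-other m (≢-sym y≢x)) my≡0) yg∈I
    where
    yg∈I : (var y · g) ∈ᴵ I
    yg∈I = cmᵃˣ (var y · g) (trans (·-var-other g y≢a) (trans (erase-other m (≢-sym a≢x)) ma≡0))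
                (trans (·-var-other g y≢x) (erase-self x m))
                (∈-resp-≗ adm (λ i → trans (·-congˡ (var y) (erase-simple x mx≡1) i)
                                           (·-left-comm (var y) (var x) g i)) ym∈)

coneAt-from-lk : Admissible I → ConeAt (lk a I) x → ConeModulo I x a → a ≢ x → ConeAt I a
coneAt-from-lk {I = I} {a = a} {x = x} adm cone cm a≢x m ma≡0 am∈ =
  ∈-by-multiplicity adm x (λ mx≡0 → cm m mx≡0 ma≡0 am∈) g∈I
  where
  g = erase x m
  g∈I : m x ≡ 1 → g ∈ᴵ I
  g∈I mx≡1 = cm g (erase-self x m) (trans (erase-other m (≢-sym a≢x)) ma≡0)
                (cone g (erase-self x m) (∈-resp-≗ adm (·-congˡ (var a) (erase-simple x mx≡1)) am∈))

var-∈⇒coneAt : Admissible J → var a ∈ᴵ J → ConeModulo J a b → ConeAt J b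
var-∈⇒coneAt {a = a} adm a∈J cm m mb≡0 bm∈ with m a ≟ 0
... | no ma≢0  = closed adm _ _ (var-∣ ma≢0) a∈J
... | yes ma≡0 = cm m ma≡0 mb≡0 bm∈

coneAt-lk-of-coneModulo : Admissible J → ConeAt J x → ConeModulo J x b → b ≢ x → ConeAt (lk x J) b
coneAt-lk-of-coneModulo {x = x} {b = b} adm cone cm b≢x m mb≡0 bm∈ with m x ≟ 0
... | no mx≢0  = var-·-∈ adm x mx≢0
... | yes mx≡0 = ∈-·ˡ adm (var x) (cm m mx≡0 mb≡0 (cone (var b · m) (trans (·-var-other m b≢x) mx≡0) bm∈))

≗-from-two-points : {A : Set} {f g : Fin n → A} (a b : Fin n) → f a ≡ g a → f b ≡ g b →
                    (∀ i → i ≢ a → i ≢ b → f i ≡ g i) → f ≗ g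
≗-from-two-points a b fa≡ga fb≡gb elsewhere i with i ≟ᶠ a | i ≟ᶠ b
... | yes refl | _        = fa≡ga
... | no _     | yes refl = fb≡gb
... | no i≢a   | no i≢b   = elsewhere i i≢a i≢b

Swaps : Fin n → Fin n → (Fin n → Fin n) → Set
Swaps {n} a b t = t a ≡ b × t b ≡ a × (∀ (i : Fin n) → i ≢ a → i ≢ b → t i ≡ i)

swaps-sym : {t : Fin n → Fin n} → Swaps a b t → Swaps b a t
swaps-sym (ta , tb , fixed) = tb , ta , λ i i≢b i≢a → fixed i i≢a i≢b

swaps-involutive : {t : Fin n → Fin n} → Swaps a b t → ∀ i → t (t i) ≡ i
swaps-involutive {a = a} {b = b} {t = t} (ta , tb , fixed) =
  ≗-from-two-points a b (trans (cong t ta) tb) (trans (cong t tb) ta)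
                        (λ i i≢a i≢b → trans (cong t (fixed i i≢a i≢b)) (fixed i i≢a i≢b))

transpose-swaps : (a b : Fin n) → Swaps a b (transpose a b ⟨$⟩ʳ_)
transpose-swaps a b = at-a , at-b , elsewhere
  where
  at-a : transpose a b ⟨$⟩ʳ a ≡ b
  at-a with a ≟ᶠ a
  ... | yes _   = refl
  ... | no a≢a = ⊥-elim (a≢a refl)
  at-b : transpose a b ⟨$⟩ʳ b ≡ a
  at-b with b ≟ᶠ a
  ... | yes b≡a = b≡a
  ... | no _ with b ≟ᶠ b
  ...   | yes _   = refl
  ...   | no b≢b = ⊥-elim (b≢b refl)
  elsewhere : ∀ i → i ≢ a → i ≢ b → transpose a b ⟨$⟩ʳ i ≡ i
  elsewhere i i≢a i≢b with i ≟ᶠ a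
  ... | yes i≡a = ⊥-elim (i≢a i≡a)
  ... | no _ with i ≟ᶠ b
  ...   | yes i≡b = ⊥-elim (i≢b i≡b)
  ...   | no _    = refl

swap-∈ : {t : Fin n → Fin n} → Admissible I → ConeModulo I b a → Swaps a b t → a ≢ b →
         (var a · m) ∈ᴵ I → (var b · (m ∘ t)) ∈ᴵ I
swap-∈ {b = b} {a = a} {m = m} {t = t} adm cm (ta , tb , fixed) a≢b am∈ with m a ≟ 0
... | no ma≢0  = var-·-∈ adm b (λ mta≡0 → ma≢0 (trans (sym (cong m tb)) mta≡0))
... | yes ma≡0 with multiplicity (m b)
...   | absent mb≡0  =
  ∈-resp-≗ adm (·-congˡ (var b) (sym ∘ mt≗m)) (∈-·ˡ adm (var b) (cm m mb≡0 ma≡0 am∈))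
  where
  mt≗m : m ∘ t ≗ m
  mt≗m = ≗-from-two-points a b (trans (cong m ta) (trans mb≡0 (sym ma≡0)))
                                (trans (cong m tb) (trans ma≡0 (sym mb≡0)))
                                (λ i i≢a i≢b → cong m (fixed i i≢a i≢b))
...   | repeated 2≤mb =
  square-∈ adm a (subst (2 ≤_) (sym (trans (·-var-other (m ∘ t) (≢-sym a≢b)) (cong m ta))) 2≤mb)
...   | simple mb≡1  = ∈-resp-≗ adm (≗-from-two-points a b at-a at-b elsewhere) am∈
  where
  at-a : var a a + m a ≡ var b a + m (t a)
  at-a = trans (cong₂ _+_ (var-self a) ma≡0) (sym (cong₂ _+_ (var-other (≢-sym a≢b)) (trans (cong m ta) mb≡1)))
  at-b : var a b + m b ≡ var b b + m (t b)
  at-b = trans (cong₂ _+_ (var-other a≢b) mb≡1) (sym (cong₂ _+_ (var-self b) (trans (cong m tb) ma≡0)))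
  elsewhere : ∀ i → i ≢ a → i ≢ b → var a i + m i ≡ var b i + m (t i)
  elsewhere i i≢a i≢b =
    cong₂ _+_ (trans (var-other (≢-sym i≢a)) (sym (var-other (≢-sym i≢b)))) (sym (cong m (fixed i i≢a i≢b)))

lk-transpose : Admissible I → ConeModulo I a b → ConeModulo I b a → a ≢ b →
               lk a I ≐ permIdeal (transpose a b) (lk b I)
lk-transpose {I = I} {a = a} {b = b} adm cmᵃᵇ cmᵇᵃ a≢b m =
  ⇔→≡ (mk⇔ (swap-∈ adm cmᵇᵃ swaps a≢b) back)
  where
  swaps = transpose-swaps a b
  back : (var b · (m ∘ (transpose a b ⟨$⟩ʳ_))) ∈ᴵ I → (var a · m) ∈ᴵ I
  back = ∈-resp-≗ adm (·-congˡ (var a) (cong m ∘ swaps-involutive swaps))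
       ∘ swap-∈ adm cmᵃᵇ (swaps-sym swaps) (≢-sym a≢b)

-- Resolutions

isCone-resp-≐ : I ≐ J → IsCone I c → IsCone J c
isCone-resp-≐ I≐J cone m = trans (sym (I≐J _)) (trans (cone m) (cong (_∨ _) (I≐J m)))

dominates-resp-≐ : I ≐ J → Dominates I a b → Dominates J a b
dominates-resp-≐ I≐J (¬cone , deletionCone) =
  ¬cone ∘ isCone-resp-≐ (sym ∘ I≐J) , isCone-resp-≐ (λ m → cong (_∨ _) (I≐J m)) deletionCone

ResolutionStep : Ideal n → Fin n → Set
ResolutionStep {n} J a = ¬ (var a ∈ᴵ J) × (IsCone J a ⊎ Σ (Fin n) (λ b → Dominates J a b))

resolutionStep-resp-≐ : I ≐ J → ResolutionStep I a → ResolutionStep J a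
resolutionStep-resp-≐ I≐J =
  map× (_∘ trans (I≐J _)) (map⊎ (isCone-resp-≐ I≐J) (map₂ (dominates-resp-≐ I≐J)))

resolutionStep⇒step : Admissible I → ResolutionStep I a → Step I a
resolutionStep⇒step adm = map₂ (map⊎ isCone⇒coneAt (map₂ (dominates⇒dominance adm)))

step⇒resolutionStep : Admissible I → Step I a → ResolutionStep I a
step⇒resolutionStep adm = map₂ (map⊎ (coneAt⇒isCone adm) (map₂ (dominance⇒dominates adm)))

-- (I : a a₂ ⋯ aᵣ) = ((I : a) : a₂ ⋯ aᵣ), so resolutions and cores can be defined by recursion on the list.
Resolution′ : Ideal n → List (Fin n) → Set
Resolution′ I []      = ⊤
Resolution′ I (a ∷ A) = Step I a × Resolution′ (lk a I) A

Spherical′ : Ideal n → List (Fin n) → Set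
Spherical′ I []      = ⊤
Spherical′ I (a ∷ A) = ¬ ConeAt I a × Spherical′ (lk a I) A

Maximal′ : Ideal n → List (Fin n) → Set
Maximal′ {n} I A = Resolution′ I A × (∀ (x : Fin n) → ¬ Resolution′ I (A ++ [ x ]))

core′ : Ideal n → List (Fin n) → Ideal n
core′ I []      = I
core′ I (a ∷ A) = core′ (lk a I) A

stage-suc : Admissible I → (a : Fin n) (A : List (Fin n)) (k : ℕ) → stage I (a ∷ A) (suc k) ≐ stage (lk a I) A k
stage-suc adm a A k m = member-resp-≗ adm (·-assoc (var a) (prodVars (take k A)) m)

resolution⇒resolution′ : Admissible I → (A : List (Fin n)) → Resolution I A → Resolution′ I A
resolution⇒resolution′ adm []      _   = tt
resolution⇒resolution′ adm (a ∷ A) res =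
  resolutionStep⇒step adm (res fzero) ,
  resolution⇒resolution′ (admissible-lk adm a) A
    (λ i → resolutionStep-resp-≐ (stage-suc adm a A (toℕ i)) (res (fsuc i)))

resolution′⇒resolution : Admissible I → (A : List (Fin n)) → Resolution′ I A → Resolution I A
resolution′⇒resolution adm (a ∷ A) (step , _)   fzero    = step⇒resolutionStep adm step
resolution′⇒resolution adm (a ∷ A) (_    , res) (fsuc i) =
  resolutionStep-resp-≐ (sym ∘ stage-suc adm a A (toℕ i)) (resolution′⇒resolution (admissible-lk adm a) A res i)

spherical⇒spherical′ : Admissible I → (A : List (Fin n)) → SphericalRes I A → Spherical′ I A
spherical⇒spherical′ adm []      _   = tt
spherical⇒spherical′ adm (a ∷ A) sph =
  sph fzero ∘ coneAt⇒isCone adm ,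
  spherical⇒spherical′ (admissible-lk adm a) A
    (λ i → sph (fsuc i) ∘ isCone-resp-≐ (sym ∘ stage-suc adm a A (toℕ i)))

spherical′⇒spherical : Admissible I → (A : List (Fin n)) → Spherical′ I A → SphericalRes I A
spherical′⇒spherical adm (a ∷ A) (¬cone , _)   fzero    = ¬cone ∘ isCone⇒coneAt
spherical′⇒spherical adm (a ∷ A) (_     , sph) (fsuc i) =
  spherical′⇒spherical (admissible-lk adm a) A sph i ∘ isCone-resp-≐ (stage-suc adm a A (toℕ i))

maximal⇒maximal′ : Admissible I → (A : List (Fin n)) → MaximalResolution I A → Maximal′ I A
maximal⇒maximal′ adm A (res , maximal) =
  resolution⇒resolution′ adm A res , λ x res′ → maximal x (resolution′⇒resolution adm (A ++ [ x ]) res′)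

core≐core′ : Admissible I → (A : List (Fin n)) → core I A ≐ core′ I A
core≐core′ adm []      m = refl
core≐core′ adm (a ∷ A) m =
  trans (member-resp-≗ adm (·-assoc (var a) (prodVars A) m)) (core≐core′ (admissible-lk adm a) A m)

admissible-core′ : Admissible I → (A : List (Fin n)) → Admissible (core′ I A)
admissible-core′ adm []      = adm
admissible-core′ adm (a ∷ A) = admissible-core′ (admissible-lk adm a) A

-- Renaming the variables

record _≅_ (X Y : Ideal n) : Set where
  constructor iso
  field
    permutation : Permutation′ n
    ≐permIdeal  : X ≐ permIdeal permutation Y

≐⇒≅ : X ≐ Y → X ≅ Y
≐⇒≅ = iso idₚ

≅-trans : X ≅ Y → Y ≅ Z → X ≅ Z
≅-trans (iso σ X≐σY) (iso τ Y≐τZ) = iso (τ ∘ₚ σ) λ m → trans (X≐σY m) (Y≐τZ _)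

permIdeal-sym : Admissible Y → X ≐ permIdeal σ Y → Y ≐ permIdeal (flip σ) X
permIdeal-sym {σ = σ} admY X≐σY m =
  trans (member-resp-≗ admY (λ i → cong m (sym (inverseˡ σ)))) (sym (X≐σY _))

≅-sym : Admissible Y → X ≅ Y → Y ≅ X
≅-sym {X = X} admY (iso σ X≐σY) = iso (flip σ) (permIdeal-sym {X = X} {σ = σ} admY X≐σY)

⟨$⟩ʳ-injective : (σ : Permutation′ n) {i j : Fin n} → σ ⟨$⟩ʳ i ≡ σ ⟨$⟩ʳ j → i ≡ j
⟨$⟩ʳ-injective σ σi≡σj = trans (sym (inverseˡ σ)) (trans (cong (σ ⟨$⟩ˡ_) σi≡σj) (inverseˡ σ))

var-⟨$⟩ʳ : (σ : Permutation′ n) (y i : Fin n) → var (σ ⟨$⟩ʳ y) (σ ⟨$⟩ʳ i) ≡ var y i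
var-⟨$⟩ʳ σ y i with y ≟ᶠ i
... | yes refl = var-self (σ ⟨$⟩ʳ y)
... | no y≢i   = var-other (y≢i ∘ ⟨$⟩ʳ-injective σ)

map-⟨$⟩ˡ-⟨$⟩ʳ : (σ : Permutation′ n) (A : List (Fin n)) → map (σ ⟨$⟩ˡ_) (map (σ ⟨$⟩ʳ_) A) ≡ A
map-⟨$⟩ˡ-⟨$⟩ʳ σ A = trans (sym (map-∘ A)) (trans (map-cong (λ _ → inverseˡ σ) A) (map-id A))

record Renaming (σ : Permutation′ n) (X Y : Ideal n) : Set where
  field
    source  : Admissible X
    target  : Admissible Y
    renames : X ≐ permIdeal σ Y

module _ {σ : Permutation′ n} {X Y : Ideal n} (ren : Renaming σ X Y) where
  open Renaming ren

  private
    π : Fin n → Fin n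
    π = σ ⟨$⟩ʳ_

  renaming-sym : Renaming (flip σ) Y X
  renaming-sym = record { source = target ; target = source ; renames = permIdeal-sym {X = X} {σ = σ} target renames }

  renaming-lk : (y : Fin n) → Renaming σ (lk (π y) X) (lk y Y)
  renaming-lk y = record
    { source  = admissible-lk source (π y)
    ; target  = admissible-lk target y
    ; renames = λ m → trans (renames _) (member-resp-≗ target (λ i → cong (_+ m (π i)) (var-⟨$⟩ʳ σ y i)))
    }

  var-∉-rename : (y : Fin n) → ¬ (var y ∈ᴵ Y) → ¬ (var (π y) ∈ᴵ X)
  var-∉-rename y y∉Y πy∈X = y∉Y (∈-resp-≗ target (var-⟨$⟩ʳ σ y) (trans (sym (renames _)) πy∈X))

  coneAt-rename : (y : Fin n) → ConeAt Y y → ConeAt X (π y)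
  coneAt-rename y cone m mπy≡0 πy·m∈X =
    trans (renames m) (cone (m ∘ π) mπy≡0 (trans (sym (Renaming.renames (renaming-lk y) m)) πy·m∈X))

  coneModulo-rename : (a b : Fin n) → ConeModulo Y a b → ConeModulo X (π a) (π b)
  coneModulo-rename a b cm m mπa≡0 mπb≡0 πb·m∈X =
    trans (renames m) (cm (m ∘ π) mπa≡0 mπb≡0 (trans (sym (Renaming.renames (renaming-lk b) m)) πb·m∈X))

¬coneAt-rename : Renaming σ X Y → (y : Fin n) → ¬ ConeAt Y y → ¬ ConeAt X (σ ⟨$⟩ʳ y)
¬coneAt-rename {σ = σ} {Y = Y} ren y ¬cone cone =
  ¬cone (subst (ConeAt Y) (inverseˡ σ) (coneAt-rename (renaming-sym ren) (σ ⟨$⟩ʳ y) cone))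

step-rename : Renaming σ X Y → (y : Fin n) → Step Y y → Step X (σ ⟨$⟩ʳ y)
step-rename ren y (y∉Y , inj₁ cone) = var-∉-rename ren y y∉Y , inj₁ (coneAt-rename ren y cone)
step-rename {σ = σ} ren y (y∉Y , inj₂ (b , dominance y≢b ¬cone cm)) =
  var-∉-rename ren y y∉Y ,
  inj₂ (σ ⟨$⟩ʳ b , dominance (y≢b ∘ ⟨$⟩ʳ-injective σ) (¬coneAt-rename ren b ¬cone)
                              (coneModulo-rename ren y b cm))

resolution′-rename : Renaming σ X Y → (A : List (Fin n)) → Resolution′ Y A → Resolution′ X (map (σ ⟨$⟩ʳ_) A)
resolution′-rename ren []      _            = tt
resolution′-rename ren (a ∷ A) (step , res) = step-rename ren a step , resolution′-rename (renaming-lk ren a) A res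

spherical′-rename : Renaming σ X Y → (A : List (Fin n)) → Spherical′ Y A → Spherical′ X (map (σ ⟨$⟩ʳ_) A)
spherical′-rename ren []      _             = tt
spherical′-rename ren (a ∷ A) (¬cone , sph) =
  ¬coneAt-rename ren a ¬cone , spherical′-rename (renaming-lk ren a) A sph

maximal′-rename : Renaming σ X Y → (A : List (Fin n)) → Maximal′ Y A → Maximal′ X (map (σ ⟨$⟩ʳ_) A)
maximal′-rename {σ = σ} {Y = Y} ren A (res , maximal) = resolution′-rename ren A res , unextendable
  where
  unextendable : ∀ x → ¬ Resolution′ _ (map (σ ⟨$⟩ʳ_) A ++ [ x ])
  unextendable x res′ =
    maximal (σ ⟨$⟩ˡ x) (subst (Resolution′ Y) unrename (resolution′-rename (renaming-sym ren) _ res′))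
    where
    unrename : map (σ ⟨$⟩ˡ_) (map (σ ⟨$⟩ʳ_) A ++ [ x ]) ≡ A ++ [ σ ⟨$⟩ˡ x ]
    unrename = trans (map-++ _ (map _ A) [ x ]) (cong (_++ [ σ ⟨$⟩ˡ x ]) (map-⟨$⟩ˡ-⟨$⟩ʳ σ A))

core′-rename : Renaming σ X Y → (A : List (Fin n)) → core′ X (map (σ ⟨$⟩ʳ_) A) ≐ permIdeal σ (core′ Y A)
core′-rename ren []      = Renaming.renames ren
core′-rename ren (a ∷ A) = core′-rename (renaming-lk ren a) A

-- The induction on the depth

record SphericalWith (I : Ideal n) (d : ℕ) (C : Ideal n) : Set where
  constructor sphericalWith
  field
    resolution : List (Fin n)
    maximal    : Maximal′ I resolution
    spherical  : Spherical′ I resolution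
    depth≡     : length resolution ≡ d
    core≅      : core′ I resolution ≅ C

sphericalWith-rename : Renaming σ X Y → SphericalWith Y d C → SphericalWith X d C
sphericalWith-rename {σ = σ} ren (sphericalWith A max sph len core≅) =
  sphericalWith (map (σ ⟨$⟩ʳ_) A) (maximal′-rename ren A max) (spherical′-rename ren A sph)
                (trans (length-map _ A) len) (≅-trans (iso σ (core′-rename ren A)) core≅)

sphericalWith-resp-≐ : Admissible X → Admissible Y → X ≐ Y → SphericalWith Y d C → SphericalWith X d C
sphericalWith-resp-≐ admX admY X≐Y =
  sphericalWith-rename {σ = idₚ} (record { source = admX ; target = admY ; renames = X≐Y })

sphericalWith-zero⇒¬step : SphericalWith I 0 C → ¬ Step I a
sphericalWith-zero⇒¬step (sphericalWith [] (_ , maximal) _ _ _) step = maximal _ (step , tt)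

sphericalWith-step⇒suc-pred : SphericalWith I d C → Step I a → suc (pred d) ≡ d
sphericalWith-step⇒suc-pred {d = zero}  good step = ⊥-elim (sphericalWith-zero⇒¬step good step)
sphericalWith-step⇒suc-pred {d = suc d} good step = refl

sphericalWith-uncons : SphericalWith I (suc d) C →
                       Σ (Fin n) λ a → Step I a × ¬ ConeAt I a × SphericalWith (lk a I) d C
sphericalWith-uncons (sphericalWith (a ∷ A) ((step , res) , maximal) (¬cone , sph) len core≅) =
  a , step , ¬cone , sphericalWith A (res , λ x res′ → maximal x (step , res′)) sph (suc-injective len) core≅

sphericalWith-cons : Step I a → ¬ ConeAt I a → SphericalWith (lk a I) d C → SphericalWith I (suc d) C
sphericalWith-cons {a = a} step ¬cone (sphericalWith A (res , maximal) sph len core≅) =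
  sphericalWith (a ∷ A) ((step , res) , λ x → maximal x ∘ proj₂) (¬cone , sph) (cong suc len) core≅

StepInvariant : ℕ → ℕ → Set
StepInvariant n d = ∀ {I C : Ideal n} → Admissible I → SphericalWith I d C →
  ∀ {a} → Step I a → ¬ ConeAt I a × SphericalWith (lk a I) (pred d) C

sphericalWith⇒¬coneAt : {I C : Ideal n} → StepInvariant n d → Admissible I → SphericalWith I d C →
         ¬ (one ∈ᴵ I) → ∀ c → ¬ ConeAt I c
sphericalWith⇒¬coneAt {I = I} inv adm good one∉I c cone with var c ∈ᴵ? I
... | yes c∈I = one∉I (cone one refl (∈-resp-≗ adm (sym ∘ ·-identityʳ (var c)) c∈I))
... | no c∉I  = proj₁ (inv adm good (c∉I , inj₁ cone)) cone

sphericalWith-exchange : {I C : Ideal n} → StepInvariant n d → Admissible I →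
  a ≢ a₀ → ¬ ((var a₀ · var a) ∈ᴵ I) → Dominance I a₀ b₀ → ¬ ConeAt I a → ConeModulo I a b → b ≢ a₀ → b ≢ a →
  SphericalWith (lk a (lk a₀ I)) d C → SphericalWith (lk a I) (suc d) C
sphericalWith-exchange {a = a} {a₀ = a₀} {b₀ = b₀} {b = b} {I = I} inv adm a≢a₀ a₀a∉I (dominance a₀≢b₀ _ cm₀)
                       ¬coneA cm b≢a₀ b≢a good =
  sphericalWith-cons (a₀∉Iₐ , inj₂ dominanceA₀) ¬coneA₀ good′
  where
  Iₐ = lk a I
  admₐ = admissible-lk adm a
  good′ : SphericalWith (lk a₀ Iₐ) _ _
  good′ = sphericalWith-resp-≐ (admissible-lk admₐ a₀) (admissible-lk (admissible-lk adm a₀) a)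
            (λ m → member-resp-≗ adm (·-left-comm (var a) (var a₀) m)) good
  noApex′ : ∀ c → ¬ ConeAt (lk a₀ Iₐ) c
  noApex′ = sphericalWith⇒¬coneAt inv (admissible-lk admₐ a₀) good′
              (a₀a∉I ∘ ∈-resp-≗ adm (λ i → trans (·-congˡ (var a) (·-identityʳ (var a₀)) i)
                                                  (·-comm (var a) (var a₀) i)))
  a₀∉Iₐ : ¬ (var a₀ ∈ᴵ Iₐ)
  a₀∉Iₐ = a₀a∉I ∘ ∈-resp-≗ adm (·-comm (var a) (var a₀))
  ¬coneAt-Iₐ : ∀ c → c ≢ a₀ → ¬ ConeAt Iₐ c
  ¬coneAt-Iₐ c c≢a₀ cone = noApex′ c (coneAt-lk admₐ cone c≢a₀)
  ¬coneA₀ : ¬ ConeAt Iₐ a₀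
  ¬coneA₀ cone with b₀ ≟ᶠ a
  ... | yes refl = ¬coneA (coneAt-from-lk adm cone cm₀ a≢a₀)
  ... | no b₀≢a  =
    noApex′ b₀ (coneAt-lk-of-coneModulo admₐ cone (coneModulo-lk adm cm₀ b₀≢a (≢-sym a≢a₀)) (≢-sym a₀≢b₀))
  dominanceA₀ : Σ (Fin _) (Dominance Iₐ a₀)
  dominanceA₀ with b₀ ≟ᶠ a
  ... | yes refl = b  , dominance (≢-sym b≢a₀) (¬coneAt-Iₐ b b≢a₀)
                          (coneModulo-lk adm (coneModulo-trans adm cm₀ cm b≢a₀ b≢a (≢-sym a≢a₀)) b≢a (≢-sym a≢a₀))
  ... | no b₀≢a  = b₀ , dominance a₀≢b₀ (¬coneAt-Iₐ b₀ (≢-sym a₀≢b₀))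
                          (coneModulo-lk adm cm₀ b₀≢a (≢-sym a≢a₀))

sphericalWith-lk-via : {I C : Ideal n} → StepInvariant n d → StepInvariant n (pred d) → Admissible I →
  SphericalWith (lk a₀ I) d C → (∀ c → ¬ ConeAt (lk a₀ I) c) → Dominance I a₀ b₀ → ¬ ConeAt I a → a ≢ a₀ →
  ConeModulo I a b → b ≢ a₀ → b ≢ a → SphericalWith (lk a I) d C
sphericalWith-lk-via {a₀ = a₀} {a = a} {b = b} {I = I} inv inv′ adm good₀ noApex₀ dom₀ ¬coneA a≢a₀ cm b≢a₀ b≢a
  with (var a₀ · var a) ∈ᴵ? I
... | yes a₀a∈I = ⊥-elim (noApex₀ b (var-∈⇒coneAt (admissible-lk adm a₀) a₀a∈I (coneModulo-lk adm cm b≢a₀ a≢a₀)))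
... | no a₀a∉I  =
  subst (λ k → SphericalWith (lk a I) k _) (sphericalWith-step⇒suc-pred good₀ stepA)
        (sphericalWith-exchange inv′ adm a≢a₀ a₀a∉I dom₀ ¬coneA cm b≢a₀ b≢a
           (proj₂ (inv (admissible-lk adm a₀) good₀ stepA)))
  where
  stepA : Step (lk a₀ I) a
  stepA = a₀a∉I , inj₂ (b , dominance (≢-sym b≢a) (noApex₀ b) (coneModulo-lk adm cm b≢a₀ a≢a₀))

stepInvariant-suc : StepInvariant n d → StepInvariant n (pred d) → StepInvariant n (suc d)
stepInvariant-suc inv inv′ {I} adm good {a} step with sphericalWith-uncons good
... | a₀ , step₀ , ¬coneA₀ , good₀ with a ≟ᶠ a₀
...   | yes refl = ¬coneA₀ , good₀
...   | no a≢a₀  = ¬coneA , goodA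
  where
  noApex₀ : ∀ c → ¬ ConeAt (lk a₀ I) c
  noApex₀ = sphericalWith⇒¬coneAt inv (admissible-lk adm a₀) good₀ (proj₁ step₀ ∘ ∈-resp-≗ adm (·-identityʳ (var a₀)))

  ¬coneA : ¬ ConeAt I a
  ¬coneA cone = noApex₀ a (coneAt-lk adm cone a≢a₀)

  goodA : SphericalWith (lk a I) _ _
  goodA with step⇒dominance step₀ ¬coneA₀ | step⇒dominance step ¬coneA
  ... | b₀ , dom₀@(dominance a₀≢b₀ _ cm₀) | b , dominance a≢b _ cm with b ≟ᶠ a₀
  ...   | no b≢a₀ = sphericalWith-lk-via inv inv′ adm good₀ noApex₀ dom₀ ¬coneA a≢a₀ cm b≢a₀ (≢-sym a≢b)
  ...   | yes refl with b₀ ≟ᶠ a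
  ...     | no b₀≢a  = sphericalWith-lk-via inv inv′ adm good₀ noApex₀ dom₀ ¬coneA a≢a₀
                         (coneModulo-trans adm cm cm₀ b₀≢a (≢-sym a₀≢b₀) a≢a₀) (≢-sym a₀≢b₀) b₀≢a
  ...     | yes refl = sphericalWith-rename ren good₀
    where
    ren : Renaming (transpose a a₀) (lk a I) (lk a₀ I)
    ren = record { source  = admissible-lk adm a ; target = admissible-lk adm a₀
                 ; renames = lk-transpose adm cm cm₀ a≢a₀ }

stepInvariant : ∀ d → StepInvariant n d
stepInvariant zero          adm good step = ⊥-elim (sphericalWith-zero⇒¬step good step)
stepInvariant (suc zero)    = stepInvariant-suc (stepInvariant zero) (stepInvariant zero)
stepInvariant (suc (suc d)) = stepInvariant-suc (stepInvariant (suc d)) (stepInvariant d)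

resolution′⇒spherical′ : Admissible I → SphericalWith I d C →
                         (A : List (Fin n)) → Resolution′ I A → Spherical′ I A
resolution′⇒spherical′ adm good []      _            = tt
resolution′⇒spherical′ adm good (a ∷ A) (step , res) with stepInvariant _ adm good step
... | ¬cone , good′ = ¬cone , resolution′⇒spherical′ (admissible-lk adm a) good′ A res

maximal′⇒depth-core : Admissible I → SphericalWith I d C →
                      (A : List (Fin n)) → Maximal′ I A → length A ≡ d × core′ I A ≅ C
maximal′⇒depth-core adm (sphericalWith [] _ _ len core≅) [] _ = len , core≅
maximal′⇒depth-core adm (sphericalWith (a₀ ∷ _) ((step₀ , _) , _) _ _ _) [] (_ , maximal) =
  ⊥-elim (maximal a₀ (step₀ , tt))
maximal′⇒depth-core adm good (a ∷ A) ((step , res) , maximal) with stepInvariant _ adm good step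
... | _ , good′ with maximal′⇒depth-core (admissible-lk adm a) good′ A (res , λ x res′ → maximal x (step , res′))
...   | len , core≅ = trans (cong suc len) (sphericalWith-step⇒suc-pred good step) , core≅

theorem4p10 : ∀ {n : ℕ} (I : Ideal n) → IsMonomialIdeal I → ContainsSquares I → SphericalIdeal I →
    (∀ (A : List (Fin n)) → Resolution I A → SphericalRes I A)
  × (∀ (A A′ : List (Fin n)) → MaximalResolution I A → MaximalResolution I A′ → depth A ≡ depth A′)
  × (∀ (A A′ : List (Fin n)) → MaximalResolution I A → MaximalResolution I A′ →
      Σ (Permutation′ n) (λ σ → core I A ≐ permIdeal σ (core I A′)))
theorem4p10 {n} I isMonomial hasSquares (A₀ , maximal₀ , spherical₀) =
    (λ A res → spherical′⇒spherical adm A (resolution′⇒spherical′ adm good A (resolution⇒resolution′ adm A res)))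
  , (λ A A′ max max′ → trans (proj₁ (depth-core A max)) (sym (proj₁ (depth-core A′ max′))))
  , (λ A A′ max max′ → let iso σ coreA≐σcoreA′ = core≅core A A′ max max′ in σ , coreA≐σcoreA′)
  where
  adm : Admissible I
  adm = record { closed = isMonomial ; squares = hasSquares }

  good : SphericalWith I (length A₀) (core′ I A₀)
  good = sphericalWith A₀ (maximal⇒maximal′ adm A₀ maximal₀) (spherical⇒spherical′ adm A₀ spherical₀)
                       refl (≐⇒≅ λ _ → refl)

  depth-core : (A : List (Fin n)) → MaximalResolution I A → length A ≡ length A₀ × core′ I A ≅ core′ I A₀
  depth-core A maximal = maximal′⇒depth-core adm good A (maximal⇒maximal′ adm A maximal)

  core≅core : (A A′ : List (Fin n)) → MaximalResolution I A → MaximalResolution I A′ → core I A ≅ core I A′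
  core≅core A A′ max max′ =
    ≅-trans (≐⇒≅ (core≐core′ adm A))
   (≅-trans (proj₂ (depth-core A max))
   (≅-trans (≅-sym (admissible-core′ adm A₀) (proj₂ (depth-core A′ max′)))
            (≐⇒≅ (sym ∘ core≐core′ adm A′))))
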